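{- Let $C$ be a subcomplex of the cube $I^n$, and let $S$ be a subcomplex of $C$ isomorphic to $\partial I^{k+1}$, with $k \geq 1$. Then $S$ is a face-like subcomplex of $C$ if and only if $S$ is not the boundary of a $(k+1)$-dimensional face of $C$, i.e.\ $S$ is not equal to the complex $\partial \hat F$ for any $F \in C$.
   Context: A cubical complex is a finite vertex set $V$ together with a collection $C$ of subsets of $V$ (faces) such that: $\emptyset \notin C$; $\{v\} \in C$ for every $v \in V$; for each $F \in C$, the poset $\hat F = \{G \in C : G \subseteq F\}$ ordered by inclusion is isomorphic to the poset of non-empty faces of a cube; and for $F, G \in C$, $F \cap G$ is empty or in $C$. The cube $I^n$ is the cubical complex with vertex set $\{0,1\}^n$ whose faces are the vertex sets of non-empty faces of $[0,1]^n$; $\partial I^{m}$ is $I^m$ with its top face (the whole vertex set) removed, and $\partial \hat F$ is $\hat F$ with $F$ itself removed. A subcomplex is a subset of vertices and faces forming a cubical complex; isomorphism means a bijection of vertices which together with its inverse maps faces to faces. A subcomplex $\Gamma$ of $C$ is face-like if for every face $F \in C$, $F \cap V(\Gamma)$ is empty or a face of $\Gamma$. -}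

module Defs where

open import Data.Nat using (ℕ; zero; suc)
open import Data.Bool using (Bool; true; false; T; _∧_)
open import Data.Maybe using (Maybe; just; nothing)
open import Data.Vec using (Vec; []; _∷_)
open import Data.Product using (Σ; _×_; _,_; proj₁; ∃)
open import Data.Sum using (_⊎_)
open import Relation.Nullary using (¬_)
open import Relation.Binary.PropositionalEquality using (_≡_; _≢_)
open import Function.Bundles using (_⇔_)

-- Vertices of the ambient cube I^m are bit vectors Vec Bool m.
-- A set of vertices is a BSet m: a complete binary decision table,
-- so that two sets are equal (_≡_) iff they have the same members.

BSet : ℕ → Set
BSet zero    = Bool
BSet (suc m) = BSet m × BSet m   -- (members with head false , members with head true)

mem : ∀ {m} → BSet m → Vec Bool m → Bool
mem {zero}  b         []          = b
mem {suc m} (A₀ , A₁) (false ∷ v) = mem A₀ v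
mem {suc m} (A₀ , A₁) (true  ∷ v) = mem A₁ v

infix 4 _∈_ _⊆_
_∈_ : ∀ {m} → Vec Bool m → BSet m → Set
v ∈ A = T (mem A v)

_⊆_ : ∀ {m} → BSet m → BSet m → Set
A ⊆ B = ∀ v → v ∈ A → v ∈ B

∅ : ∀ {m} → BSet m
∅ {zero}  = false
∅ {suc m} = ∅ , ∅

full : ∀ {m} → BSet m
full {zero}  = true
full {suc m} = full , full

singleton : ∀ {m} → Vec Bool m → BSet m
singleton []          = true
singleton (false ∷ v) = singleton v , ∅
singleton (true  ∷ v) = ∅ , singleton v

infixr 7 _∩_
_∩_ : ∀ {m} → BSet m → BSet m → BSet m
_∩_ {zero}  a         b         = a ∧ b
_∩_ {suc m} (A₀ , A₁) (B₀ , B₁) = (A₀ ∩ B₀) , (A₁ ∩ B₁)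

IsEmpty : ∀ {m} → BSet m → Set
IsEmpty A = ∀ v → ¬ (v ∈ A)

-- Faces of the geometric cube [0,1]^d: a pattern fixes some coordinates
-- (just b) and leaves the others free (nothing).

data Matches : ∀ {d} → Vec (Maybe Bool) d → Vec Bool d → Set where
  []    : Matches [] []
  free  : ∀ {d b} {p : Vec (Maybe Bool) d} {v} → Matches p v → Matches (nothing ∷ p) (b ∷ v)
  fixed : ∀ {d b} {p : Vec (Maybe Bool) d} {v} → Matches p v → Matches (just b ∷ p) (b ∷ v)

-- G is the vertex set of a non-empty face of [0,1]^d
-- (every pattern describes a non-empty face).
CubeFace : (d : ℕ) → BSet d → Set
CubeFace d G = Σ (Vec (Maybe Bool) d) λ p → ∀ v → (v ∈ G) ⇔ Matches p v

record Complex (m : ℕ) : Set₁ where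
  field
    V    : BSet m
    Face : BSet m → Set
open Complex public

-- Order isomorphism between two posets whose elements are (carried by)
-- vertex sets, ordered by inclusion of these vertex sets; elements are
-- identified when their vertex sets coincide.
record InclusionIso {m d : ℕ} (A B : Set) (ιA : A → BSet m) (ιB : B → BSet d) : Set where
  field
    to        : A → B
    from      : B → A
    from-to   : ∀ a → ιA (from (to a)) ≡ ιA a
    to-from   : ∀ b → ιB (to (from b)) ≡ ιB b
    to-mono   : ∀ a a' → ιA a ⊆ ιA a' → ιB (to a) ⊆ ιB (to a')
    from-mono : ∀ b b' → ιB b ⊆ ιB b' → ιA (from b) ⊆ ιA (from b')

Below : ∀ {m} → Complex m → BSet m → Set
Below C F = Σ (BSet _) λ G → Face C G × G ⊆ F

CubeFaces : ℕ → Set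
CubeFaces d = Σ (BSet d) (CubeFace d)

record IsCubical {m : ℕ} (C : Complex m) : Set where
  field
    faces⊆V     : ∀ F → Face C F → F ⊆ V C
    no-empty    : ¬ Face C ∅
    vertices    : ∀ v → v ∈ V C → Face C (singleton v)
    cube-like   : ∀ F → Face C F →
                  Σ ℕ λ d → InclusionIso (Below C F) (CubeFaces d) proj₁ proj₁
    intersect   : ∀ F G → Face C F → Face C G → IsEmpty (F ∩ G) ⊎ Face C (F ∩ G)

Cube : (d : ℕ) → Complex d
Cube d = record { V = full ; Face = CubeFace d }

BoundaryCube : (d : ℕ) → Complex d
BoundaryCube d = record { V = full ; Face = λ G → CubeFace d G × G ≢ full }

record Subcomplex {m : ℕ} (Γ C : Complex m) : Set where
  field
    V⊆      : V Γ ⊆ V C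
    Face⊆   : ∀ G → Face Γ G → Face C G
    cubical : IsCubical Γ

record Iso {m m' : ℕ} (Γ : Complex m) (Δ : Complex m') : Set where
  field
    f     : Vec Bool m → Vec Bool m'
    g     : Vec Bool m' → Vec Bool m
    f-V   : ∀ v → v ∈ V Γ → f v ∈ V Δ
    g-V   : ∀ w → w ∈ V Δ → g w ∈ V Γ
    gf    : ∀ v → v ∈ V Γ → g (f v) ≡ v
    fg    : ∀ w → w ∈ V Δ → f (g w) ≡ w
    f-face : ∀ F → Face Γ F → Σ (BSet m') λ G → Face Δ G ×
               (∀ w → (w ∈ G) ⇔ (Σ (Vec Bool m) λ v → v ∈ F × f v ≡ w))
    g-face : ∀ G → Face Δ G → Σ (BSet m) λ F → Face Γ F ×
               (∀ v → (v ∈ F) ⇔ (Σ (Vec Bool m') λ w → w ∈ G × g w ≡ v))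

FaceLike : ∀ {m} → Complex m → Complex m → Set
FaceLike C Γ = ∀ F → Face C F → IsEmpty (F ∩ V Γ) ⊎ Face Γ (F ∩ V Γ)

IsBoundaryOf : ∀ {m} → Complex m → BSet m → Complex m → Set
IsBoundaryOf C F S =
  (∀ G → Face S G ⇔ (Face C G × G ⊆ F × G ≢ F)) ×
  (∀ v → (v ∈ V S) ⇔ (Face C (singleton v) × singleton v ⊆ F × singleton v ≢ F))

module Submission where

open import Defs
open import Data.Nat using (ℕ; zero; suc; _≤_; s≤s)
open import Data.Fin using (Fin; zero; suc)
open import Data.Fin.Properties using (any?) renaming (_≟_ to _≟ᶠ_)
open import Data.Bool using (Bool; true; false; not; _xor_)
open import Data.Bool.Properties
  using (T-∧; not-involutive; not-¬; ¬-not; not-distribʳ-xor; xor-identityʳ)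
  renaming (_≟_ to _≟ᵇ_)
open import Data.Maybe using (Maybe; just; nothing)
open import Data.Vec using (Vec; []; _∷_; lookup; tabulate; replicate; map; updateAt)
open import Data.Vec.Properties
  using (lookup∘tabulate; tabulate∘lookup; tabulate-cong; lookup-replicate; lookup∘updateAt; lookup∘updateAt′; updateAt-commutes; updateAt-updateAt; updateAt-id-local)
open import Data.Product using (Σ; _×_; _,_; proj₁; proj₂; ∃)
open import Data.Product.Properties using (≡-dec)
open import Data.Sum using (_⊎_; inj₁; inj₂)
open import Data.Empty using (⊥; ⊥-elim)
open import Data.Unit using (tt)
open import Relation.Nullary using (¬_; Dec; yes; no)
open import Relation.Binary.Definitions using (DecidableEquality)
open import Relation.Binary.PropositionalEquality
open import Function.Bundles using (_⇔_; mk⇔; Equivalence)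
open import Function.Definitions using (Injective)
open Equivalence using () renaming (to to fwd; from to bwd)

-- The isomorphism gives an injective vertex map g : I^(k+1) → I^n onto the
-- vertices of S carrying every proper face of I^(k+1) onto a face of S, hence
-- onto a face of I^n.  So g sends edges to edges, and an injective graph map
-- of cubes is a coordinate embedding: it copies the coordinates of I^(k+1)
-- to distinct coordinates of I^n, up to translation.  Therefore V(S) is a
-- face of I^n, and g pulls a face X of I^n meeting S back to a face of
-- I^(k+1): if that face is proper its image X ∩ V(S) is a face of S,
-- otherwise V(S) ⊆ X (the lemma trace).  The same argument applied to the
-- vertex map of the isomorphism F̂ ≅ (faces of I^d) shows that every face of
-- I^n inside a face F of C is a face of C; so if V(S) ⊆ F then V(S) is a
-- face of C with boundary S.

⊆-antisym : ∀ {m} {A B : BSet m} → A ⊆ B → B ⊆ A → A ≡ B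
⊆-antisym {zero} {false} {false} _ _ = refl
⊆-antisym {zero} {false} {true}  _ q = ⊥-elim (q [] tt)
⊆-antisym {zero} {true}  {false} p _ = ⊥-elim (p [] tt)
⊆-antisym {zero} {true}  {true}  _ _ = refl
⊆-antisym {suc m} {_ , _} {_ , _} p q =
  cong₂ _,_ (⊆-antisym (λ v → p (false ∷ v)) (λ v → q (false ∷ v)))
            (⊆-antisym (λ v → p (true ∷ v)) (λ v → q (true ∷ v)))

_≟ₛ_ : ∀ {m} → DecidableEquality (BSet m)
_≟ₛ_ {zero}  = _≟ᵇ_
_≟ₛ_ {suc m} = ≡-dec _≟ₛ_ _≟ₛ_

∉∅ : ∀ {m} (v : Vec Bool m) → ¬ (v ∈ ∅ {m})
∉∅ []          ()
∉∅ (false ∷ v) = ∉∅ v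
∉∅ (true ∷ v)  = ∉∅ v

∈full : ∀ {m} (v : Vec Bool m) → v ∈ full {m}
∈full []          = tt
∈full (false ∷ v) = ∈full v
∈full (true ∷ v)  = ∈full v

∈-∩ : ∀ {m} (A B : BSet m) v → v ∈ A ∩ B ⇔ (v ∈ A × v ∈ B)
∈-∩ {zero}  a        b        []          = T-∧
∈-∩ {suc m} (A₀ , _) (B₀ , _) (false ∷ v) = ∈-∩ A₀ B₀ v
∈-∩ {suc m} (_ , A₁) (_ , B₁) (true ∷ v)  = ∈-∩ A₁ B₁ v

∩-absorbs : ∀ {m} {A B : BSet m} → A ⊆ B → A ∩ B ≡ A
∩-absorbs {A = A} {B} A⊆B =
  ⊆-antisym (λ v v∈ → proj₁ (fwd (∈-∩ A B v) v∈)) (λ v v∈ → bwd (∈-∩ A B v) (v∈ , A⊆B v v∈))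

nonempty? : ∀ {m} (A : BSet m) → (Σ (Vec Bool m) λ v → v ∈ A) ⊎ IsEmpty A
nonempty? {zero} false = inj₂ (λ { [] () })
nonempty? {zero} true  = inj₁ ([] , tt)
nonempty? {suc m} (A₀ , A₁) with nonempty? A₀ | nonempty? A₁
... | inj₁ (v , p) | _            = inj₁ (false ∷ v , p)
... | inj₂ _       | inj₁ (v , p) = inj₁ (true ∷ v , p)
... | inj₂ e₀      | inj₂ e₁      = inj₂ λ { (false ∷ v) → e₀ v ; (true ∷ v) → e₁ v }

∈-singleton : ∀ {m} (u : Vec Bool m) → u ∈ singleton u
∈-singleton []          = tt
∈-singleton (false ∷ u) = ∈-singleton u
∈-singleton (true ∷ u)  = ∈-singleton u

singleton-≡ : ∀ {m} {u v : Vec Bool m} → v ∈ singleton u → v ≡ u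
singleton-≡ {u = []}        {[]}        _ = refl
singleton-≡ {u = false ∷ u} {false ∷ v} p = cong (false ∷_) (singleton-≡ p)
singleton-≡ {u = false ∷ u} {true ∷ v}  p = ⊥-elim (∉∅ v p)
singleton-≡ {u = true ∷ u}  {false ∷ v} p = ⊥-elim (∉∅ v p)
singleton-≡ {u = true ∷ u}  {true ∷ v}  p = cong (true ∷_) (singleton-≡ p)

singleton-⊆ : ∀ {m} {u : Vec Bool m} {A : BSet m} → u ∈ A → singleton u ⊆ A
singleton-⊆ {A = A} u∈ v v∈ = subst (_∈ A) (sym (singleton-≡ v∈)) u∈

Pat : ℕ → Set
Pat d = Vec (Maybe Bool) d

patSet : ∀ {d} → Pat d → BSet d
patSet []               = true
patSet (nothing ∷ p)    = patSet p , patSet p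
patSet (just false ∷ p) = patSet p , ∅
patSet (just true ∷ p)  = ∅ , patSet p

∈-patSet : ∀ {d} (p : Pat d) v → v ∈ patSet p ⇔ Matches p v
∈-patSet p v = mk⇔ (to p v) (from p v)
  where
  to : ∀ {d} (p : Pat d) v → v ∈ patSet p → Matches p v
  to []               []          _ = []
  to (nothing ∷ p)    (false ∷ v) q = free (to p v q)
  to (nothing ∷ p)    (true ∷ v)  q = free (to p v q)
  to (just false ∷ p) (false ∷ v) q = fixed (to p v q)
  to (just false ∷ p) (true ∷ v)  q = ⊥-elim (∉∅ v q)
  to (just true ∷ p)  (false ∷ v) q = ⊥-elim (∉∅ v q)
  to (just true ∷ p)  (true ∷ v)  q = fixed (to p v q)
  from : ∀ {d} (p : Pat d) v → Matches p v → v ∈ patSet p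
  from []               []          []        = tt
  from (nothing ∷ p)    (false ∷ v) (free m)  = from p v m
  from (nothing ∷ p)    (true ∷ v)  (free m)  = from p v m
  from (just false ∷ p) (false ∷ v) (fixed m) = from p v m
  from (just true ∷ p)  (true ∷ v)  (fixed m) = from p v m

patSet-face : ∀ {d} (p : Pat d) → CubeFace d (patSet p)
patSet-face p = p , ∈-patSet p

pick : ∀ {d} → Pat d → Vec Bool d
pick []            = []
pick (nothing ∷ p) = false ∷ pick p
pick (just b ∷ p)  = b ∷ pick p

pick-matches : ∀ {d} (p : Pat d) → Matches p (pick p)
pick-matches []            = []
pick-matches (nothing ∷ p) = free (pick-matches p)
pick-matches (just b ∷ p)  = fixed (pick-matches p)

cubeFace-point : ∀ {d} {G : BSet d} → CubeFace d G → Σ (Vec Bool d) λ v → v ∈ G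
cubeFace-point (p , G⇔p) = pick p , bwd (G⇔p (pick p)) (pick-matches p)

MatchesAt : ∀ {d} → Pat d → Vec Bool d → Set
MatchesAt p v = ∀ j b → lookup p j ≡ just b → lookup v j ≡ b

matches⇒at : ∀ {d} {p : Pat d} {v} → Matches p v → MatchesAt p v
matches⇒at (free m)  zero    b ()
matches⇒at (free m)  (suc j) b e    = matches⇒at m j b e
matches⇒at (fixed m) zero    b refl = refl
matches⇒at (fixed m) (suc j) b e    = matches⇒at m j b e

at⇒matches : ∀ {d} (p : Pat d) v → MatchesAt p v → Matches p v
at⇒matches []            []      _ = []
at⇒matches (nothing ∷ p) (c ∷ v) h = free (at⇒matches p v (λ j → h (suc j)))
at⇒matches (just b ∷ p)  (c ∷ v) h with h zero b refl
... | refl = fixed (at⇒matches p v (λ j → h (suc j)))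

matches-exact : ∀ {d} (u : Vec Bool d) → Matches (map just u) u
matches-exact []      = []
matches-exact (b ∷ u) = fixed (matches-exact u)

matches-exact-≡ : ∀ {d} (u v : Vec Bool d) → Matches (map just u) v → v ≡ u
matches-exact-≡ []      []       []        = refl
matches-exact-≡ (b ∷ u) (.b ∷ v) (fixed m) = cong (b ∷_) (matches-exact-≡ u v m)

singleton-face : ∀ {d} (u : Vec Bool d) → CubeFace d (singleton u)
singleton-face u = map just u , λ v →
  mk⇔ (λ v∈ → subst (Matches (map just u)) (sym (singleton-≡ v∈)) (matches-exact u))
      (λ m → subst (_∈ singleton u) (sym (matches-exact-≡ u v m)) (∈-singleton u))

toggle : ∀ {d} → Fin d → Vec Bool d → Vec Bool d
toggle i w = updateAt w i not

lookup-toggle : ∀ {d} (i : Fin d) w → lookup (toggle i w) i ≡ not (lookup w i)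
lookup-toggle i w = lookup∘updateAt i w

lookup-toggle′ : ∀ {d} {i j : Fin d} w → i ≢ j → lookup (toggle i w) j ≡ lookup w j
lookup-toggle′ {i = i} {j} w i≢j = lookup∘updateAt′ j i (λ e → i≢j (sym e)) w

toggle-involutive : ∀ {d} (i : Fin d) w → toggle i (toggle i w) ≡ w
toggle-involutive i w =
  trans (updateAt-updateAt i w) (updateAt-id-local i w (not-involutive (lookup w i)))

toggle-≢ : ∀ {d} (i : Fin d) w → toggle i w ≢ w
toggle-≢ i w e = not-¬ refl (sym (trans (sym (lookup-toggle i w)) (cong (λ x → lookup x i) e)))

toggle-direction-injective : ∀ {d} {i j : Fin d} w → toggle i w ≡ toggle j w → i ≡ j
toggle-direction-injective {i = i} {j} w e with i ≟ᶠ j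
... | yes i≡j = i≡j
... | no  i≢j = ⊥-elim (not-¬ refl (sym (begin
        not (lookup w i)        ≡⟨ lookup-toggle i w ⟨
        lookup (toggle i w) i   ≡⟨ cong (λ x → lookup x i) e ⟩
        lookup (toggle j w) i   ≡⟨ lookup-toggle′ w (λ j≡i → i≢j (sym j≡i)) ⟩
        lookup w i              ∎)))
  where open ≡-Reasoning

vec-ext : ∀ {d} (x y : Vec Bool d) → (∀ j → lookup x j ≡ lookup y j) → x ≡ y
vec-ext x y h = trans (sym (tabulate∘lookup x)) (trans (tabulate-cong h) (tabulate∘lookup y))

differ-at : ∀ {d} (x y : Vec Bool d) → x ≢ y → Σ (Fin d) λ j → lookup x j ≢ lookup y j
differ-at []      []      x≢y = ⊥-elim (x≢y refl)
differ-at (a ∷ x) (b ∷ y) x≢y with a ≟ᵇ b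
... | no a≢b  = zero , a≢b
... | yes refl with differ-at x y (λ e → x≢y (cong (a ∷_) e))
...   | j , xj≢yj = suc j , xj≢yj

cube-induction : ∀ {d} (P : Vec Bool d → Set) → P (replicate d false) →
                 (∀ w i → P w → P (toggle i w)) → ∀ w → P w
cube-induction {zero}  P p₀ step []      = p₀
cube-induction {suc d} P p₀ step (b ∷ w) = from-head b
  where
  head-false : ∀ w → P (false ∷ w)
  head-false = cube-induction (λ w → P (false ∷ w)) p₀ (λ w i → step (false ∷ w) (suc i))
  from-head : ∀ b → P (b ∷ w)
  from-head false = head-false w
  from-head true  = step (false ∷ w) zero (head-false w)

-- Squares: a common neighbour of two distinct neighbours toggle j x and
-- toggle j′ x of x, other than x itself, is toggle j′ (toggle j x).
square : ∀ {d} (x : Vec Bool d) {j j′ a b : Fin d} → j ≢ j′ →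
         toggle a (toggle j x) ≡ toggle b (toggle j′ x) → toggle a (toggle j x) ≢ x → a ≡ j′
square x {j} {j′} {a} {b} j≢j′ e y≢x with a ≟ᶠ j′ | b ≟ᶠ j′
... | yes a≡j′ | _        = a≡j′
... | no _     | yes refl = ⊥-elim (y≢x (trans e (toggle-involutive j′ x)))
... | no a≢j′  | no b≢j′  = ⊥-elim (not-¬ refl (begin
        lookup x j′                          ≡⟨ lookup-toggle′ x j≢j′ ⟨
        lookup (toggle j x) j′               ≡⟨ lookup-toggle′ (toggle j x) a≢j′ ⟨
        lookup (toggle a (toggle j x)) j′    ≡⟨ cong (λ y → lookup y j′) e ⟩
        lookup (toggle b (toggle j′ x)) j′   ≡⟨ lookup-toggle′ (toggle j′ x) b≢j′ ⟩
        lookup (toggle j′ x) j′              ≡⟨ lookup-toggle j′ x ⟩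
        not (lookup x j′)                    ∎))
  where open ≡-Reasoning

edgePat : ∀ {d} → Fin d → Vec Bool d → Pat d
edgePat zero    (b ∷ w) = nothing ∷ map just w
edgePat (suc i) (b ∷ w) = just b ∷ edgePat i w

edge : ∀ {d} → Fin d → Vec Bool d → BSet d
edge i w = patSet (edgePat i w)

edge-start : ∀ {d} (i : Fin d) w → w ∈ edge i w
edge-start i w = bwd (∈-patSet (edgePat i w) w) (go i w)
  where
  go : ∀ {d} (i : Fin d) w → Matches (edgePat i w) w
  go zero    (b ∷ w) = free (matches-exact w)
  go (suc i) (b ∷ w) = fixed (go i w)

edge-end : ∀ {d} (i : Fin d) w → toggle i w ∈ edge i w
edge-end i w = bwd (∈-patSet (edgePat i w) (toggle i w)) (go i w)
  where
  go : ∀ {d} (i : Fin d) w → Matches (edgePat i w) (toggle i w)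
  go zero    (b ∷ w) = free (matches-exact w)
  go (suc i) (b ∷ w) = fixed (go i w)

edge-members : ∀ {d} (i : Fin d) w {u} → u ∈ edge i w → u ≡ w ⊎ u ≡ toggle i w
edge-members i w {u} u∈ = go i w u (fwd (∈-patSet (edgePat i w) u) u∈)
  where
  go : ∀ {d} (i : Fin d) w u → Matches (edgePat i w) u → u ≡ w ⊎ u ≡ toggle i w
  go zero (b ∷ w) (c ∷ u) (free m) with matches-exact-≡ w u m | b ≟ᵇ c
  ... | refl | yes refl = inj₁ refl
  ... | refl | no b≢c   = inj₂ (cong (_∷ w) (¬-not (λ c≡b → b≢c (sym c≡b))))
  go (suc i) (b ∷ w) (.b ∷ u) (fixed m) with go i w u m
  ... | inj₁ refl = inj₁ refl
  ... | inj₂ refl = inj₂ refl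

ImageOf : ∀ {d n} → (Vec Bool d → Vec Bool n) → BSet d → BSet n → Set
ImageOf {d} g A B = ∀ v → v ∈ B ⇔ (Σ (Vec Bool d) λ u → u ∈ A × g u ≡ v)

NeighbourPreserving : ∀ {d n} → (Vec Bool d → Vec Bool n) → Set
NeighbourPreserving {d} {n} g = ∀ w (i : Fin d) → Σ (Fin n) λ j → g (toggle i w) ≡ toggle j (g w)

-- An injective vertex map sending an edge onto a face of I^n sends it onto
-- an edge: that face is a two-point subcube, so its two points are neighbours.
edge-to-edge : ∀ {d n} {g : Vec Bool d → Vec Bool n} → Injective _≡_ _≡_ g →
               ∀ w i {Y} → CubeFace n Y → ImageOf g (edge i w) Y →
               Σ (Fin n) λ j → g (toggle i w) ≡ toggle j (g w)
edge-to-edge {g = g} g-inj w i (q , Y⇔q) image = j , y≡toggle-x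
  where
  x = g w
  y = g (toggle i w)
  image-matches : ∀ {u} → u ∈ edge i w → Matches q (g u)
  image-matches {u} u∈ = fwd (Y⇔q (g u)) (bwd (image (g u)) (u , u∈ , refl))
  differ = differ-at x y (λ e → toggle-≢ i w (sym (g-inj e)))
  j = proj₁ differ
  -- x and y both lie in the face, so coordinate j is free in its pattern
  j-free : ∀ b → lookup q j ≢ just b
  j-free b e = proj₂ differ (trans (matches⇒at (image-matches (edge-start i w)) j b e)
                                   (sym (matches⇒at (image-matches (edge-end i w)) j b e)))
  toggle-x-matches : Matches q (toggle j x)
  toggle-x-matches = at⇒matches q (toggle j x) λ j′ b e →
    trans (lookup-toggle′ x (λ j≡j′ → j-free b (subst (λ t → lookup q t ≡ just b) (sym j≡j′) e)))
          (matches⇒at (image-matches (edge-start i w)) j′ b e)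
  y≡toggle-x : y ≡ toggle j x
  y≡toggle-x with fwd (image (toggle j x)) (bwd (Y⇔q (toggle j x)) toggle-x-matches)
  ... | u , u∈ , gu≡ with edge-members i w u∈
  ...   | inj₁ refl = ⊥-elim (toggle-≢ j x (sym gu≡))
  ...   | inj₂ refl = gu≡

record CoordinateEmbedding {d n} (g : Vec Bool d → Vec Bool n) : Set where
  field
    σ     : Fin d → Fin n
    base  : Vec Bool n
    on-σ  : ∀ w i → lookup (g w) (σ i) ≡ lookup base (σ i) xor lookup w i
    off-σ : ∀ w j → (∀ i → σ i ≢ j) → lookup (g w) j ≡ lookup base j

xor-cancelˡ : ∀ c x → c xor (c xor x) ≡ x
xor-cancelˡ false x = refl
xor-cancelˡ true  x = not-involutive x

xor-injectiveʳ : ∀ c {x y} → c xor x ≡ c xor y → x ≡ y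
xor-injectiveʳ c {x} {y} e = trans (sym (xor-cancelˡ c x)) (trans (cong (c xor_) e) (xor-cancelˡ c y))

-- The direction
-- σ i of the image of the i-th edge at the origin is the direction of the
-- image of every i-th edge, because the images of the squares of I^d are
-- squares of I^n.
module _ {d n} {g : Vec Bool d → Vec Bool n} (g-inj : Injective _≡_ _≡_ g) (nbr : NeighbourPreserving g) where

  private
    origin : Vec Bool d
    origin = replicate d false

    σ : Fin d → Fin n
    σ i = proj₁ (nbr origin i)

  uniform-directions : ∀ w i → g (toggle i w) ≡ toggle (σ i) (g w)
  uniform-directions = cube-induction _ (λ i → proj₂ (nbr origin i)) step
    where
    step : ∀ w i′ → (∀ i → g (toggle i w) ≡ toggle (σ i) (g w)) →
           ∀ i → g (toggle i (toggle i′ w)) ≡ toggle (σ i) (g (toggle i′ w))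
    step w i′ ih i with i ≟ᶠ i′
    ... | yes refl = begin
      g (toggle i (toggle i w))             ≡⟨ cong g (toggle-involutive i w) ⟩
      g w                                   ≡⟨ toggle-involutive (σ i) (g w) ⟨
      toggle (σ i) (toggle (σ i) (g w))     ≡⟨ cong (toggle (σ i)) (ih i) ⟨
      toggle (σ i) (g (toggle i w))         ∎
      where open ≡-Reasoning
    ... | no i≢i′ = begin
      y                                     ≡⟨ y≡a ⟩
      toggle a (toggle j′ x)                ≡⟨ cong (λ t → toggle t (toggle j′ x)) a≡j ⟩
      toggle j (toggle j′ x)                ≡⟨ cong (toggle j) (ih i′) ⟨
      toggle j (g (toggle i′ w))            ∎
      where
      open ≡-Reasoning
      x = g w
      j = σ i
      j′ = σ i′
      y = g (toggle i (toggle i′ w))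
      a = proj₁ (nbr (toggle i′ w) i)
      b = proj₁ (nbr (toggle i w) i′)
      y≡a : y ≡ toggle a (toggle j′ x)
      y≡a = trans (proj₂ (nbr (toggle i′ w) i)) (cong (toggle a) (ih i′))
      y≡b : y ≡ toggle b (toggle j x)
      y≡b = trans (cong g (updateAt-commutes i i′ i≢i′ w))
                  (trans (proj₂ (nbr (toggle i w) i′)) (cong (toggle b) (ih i)))
      j′≢j : j′ ≢ j
      j′≢j e = i≢i′ (sym (toggle-direction-injective w (g-inj (begin
        g (toggle i′ w)   ≡⟨ ih i′ ⟩
        toggle j′ x       ≡⟨ cong (λ t → toggle t x) e ⟩
        toggle j x        ≡⟨ ih i ⟨
        g (toggle i w)    ∎))))
      y≢x : y ≢ x
      y≢x e = i≢i′ (sym (toggle-direction-injective w (begin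
        toggle i′ w                        ≡⟨ toggle-involutive i (toggle i′ w) ⟨
        toggle i (toggle i (toggle i′ w))  ≡⟨ cong (toggle i) (g-inj e) ⟩
        toggle i w                         ∎)))
      a≡j : a ≡ j
      a≡j = square x j′≢j (trans (sym y≡a) y≡b) (λ e → y≢x (trans y≡a e))

  private
    σ-injective : ∀ {i i′} → σ i ≡ σ i′ → i ≡ i′
    σ-injective {i} {i′} e = toggle-direction-injective origin (g-inj (begin
      g (toggle i origin)       ≡⟨ uniform-directions origin i ⟩
      toggle (σ i) (g origin)   ≡⟨ cong (λ t → toggle t (g origin)) e ⟩
      toggle (σ i′) (g origin)  ≡⟨ uniform-directions origin i′ ⟨
      g (toggle i′ origin)      ∎))
      where open ≡-Reasoning

  coordinate-embedding : CoordinateEmbedding g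
  coordinate-embedding = record { σ = σ ; base = g origin ; on-σ = on-σ ; off-σ = off-σ }
    where
    off-σ : ∀ w j → (∀ i → σ i ≢ j) → lookup (g w) j ≡ lookup (g origin) j
    off-σ w j σ≢j = cube-induction (λ w → lookup (g w) j ≡ lookup (g origin) j) refl
      (λ w i ih → trans (cong (λ t → lookup t j) (uniform-directions w i))
                        (trans (lookup-toggle′ (g w) (σ≢j i)) ih)) w
    on-σ : ∀ w i → lookup (g w) (σ i) ≡ lookup (g origin) (σ i) xor lookup w i
    on-σ = cube-induction _ at-origin step
      where
      at-origin : ∀ i → lookup (g origin) (σ i) ≡ lookup (g origin) (σ i) xor lookup origin i
      at-origin i = sym (trans (cong (lookup (g origin) (σ i) xor_) (lookup-replicate i false))
                               (xor-identityʳ _))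
      step : ∀ w i′ → (∀ i → lookup (g w) (σ i) ≡ lookup (g origin) (σ i) xor lookup w i) →
             ∀ i → lookup (g (toggle i′ w)) (σ i) ≡ lookup (g origin) (σ i) xor lookup (toggle i′ w) i
      step w i′ ih i with i′ ≟ᶠ i
      ... | yes refl = begin
        lookup (g (toggle i w)) (σ i)               ≡⟨ cong (λ t → lookup t (σ i)) (uniform-directions w i) ⟩
        lookup (toggle (σ i) (g w)) (σ i)           ≡⟨ lookup-toggle (σ i) (g w) ⟩
        not (lookup (g w) (σ i))                    ≡⟨ cong not (ih i) ⟩
        not (lookup (g origin) (σ i) xor lookup w i) ≡⟨ not-distribʳ-xor (lookup (g origin) (σ i)) (lookup w i) ⟩
        lookup (g origin) (σ i) xor not (lookup w i) ≡⟨ cong (lookup (g origin) (σ i) xor_) (lookup-toggle i w) ⟨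
        lookup (g origin) (σ i) xor lookup (toggle i w) i ∎
        where open ≡-Reasoning
      ... | no i′≢i = begin
        lookup (g (toggle i′ w)) (σ i)              ≡⟨ cong (λ t → lookup t (σ i)) (uniform-directions w i′) ⟩
        lookup (toggle (σ i′) (g w)) (σ i)          ≡⟨ lookup-toggle′ (g w) (λ e → i′≢i (σ-injective e)) ⟩
        lookup (g w) (σ i)                          ≡⟨ ih i ⟩
        lookup (g origin) (σ i) xor lookup w i      ≡⟨ cong (lookup (g origin) (σ i) xor_) (lookup-toggle′ w i′≢i) ⟨
        lookup (g origin) (σ i) xor lookup (toggle i′ w) i ∎
        where open ≡-Reasoning

module _ {d n} {g : Vec Bool d → Vec Bool n} (emb : CoordinateEmbedding g) where
  open CoordinateEmbedding emb

  -- If a face X of I^n meets the image of g, then g⁻¹(X) is a face of I^d: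
  -- coordinate i is constrained iff X constrains coordinate σ i, and then
  -- to its value at any point w₀ of g⁻¹(X).
  preimage-face : ∀ {X w₀} → CubeFace n X → g w₀ ∈ X →
                  Σ (BSet d) λ Q → CubeFace d Q × (∀ w → g w ∈ X ⇔ w ∈ Q)
  preimage-face {X} {w₀} (p , X⇔p) gw₀∈X =
    patSet Q , patSet-face Q , λ w → mk⇔ (to w) (from w)
    where
    gw₀-matches : MatchesAt p (g w₀)
    gw₀-matches = matches⇒at (fwd (X⇔p (g w₀)) gw₀∈X)
    constrain : Maybe Bool → Bool → Maybe Bool
    constrain nothing  _ = nothing
    constrain (just _) c = just c
    Q : Pat d
    Q = tabulate λ i → constrain (lookup p (σ i)) (lookup w₀ i)
    to : ∀ w → g w ∈ X → w ∈ patSet Q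
    to w gw∈X = bwd (∈-patSet Q w) (at⇒matches Q w λ i b e →
                  agree i b (trans (sym (lookup∘tabulate _ i)) e))
      where
      gw-matches = matches⇒at (fwd (X⇔p (g w)) gw∈X)
      agree : ∀ i b → constrain (lookup p (σ i)) (lookup w₀ i) ≡ just b → lookup w i ≡ b
      agree i b e with lookup p (σ i) in pσi
      agree i b refl | just c = xor-injectiveʳ (lookup base (σ i)) (begin
        lookup base (σ i) xor lookup w i    ≡⟨ on-σ w i ⟨
        lookup (g w) (σ i)                  ≡⟨ gw-matches (σ i) c pσi ⟩
        c                                   ≡⟨ gw₀-matches (σ i) c pσi ⟨
        lookup (g w₀) (σ i)                 ≡⟨ on-σ w₀ i ⟩
        lookup base (σ i) xor lookup w₀ i   ∎)
        where open ≡-Reasoning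
    from : ∀ w → w ∈ patSet Q → g w ∈ X
    from w w∈Q = bwd (X⇔p (g w)) (at⇒matches p (g w) agree)
      where
      w-matches = matches⇒at (fwd (∈-patSet Q w) w∈Q)
      agree : ∀ j c → lookup p j ≡ just c → lookup (g w) j ≡ c
      agree j c pj with any? (λ i → σ i ≟ᶠ j)
      ... | yes (i , refl) = begin
        lookup (g w) (σ i)                   ≡⟨ on-σ w i ⟩
        lookup base (σ i) xor lookup w i     ≡⟨ cong (lookup base (σ i) xor_) wi≡w₀i ⟩
        lookup base (σ i) xor lookup w₀ i    ≡⟨ on-σ w₀ i ⟨
        lookup (g w₀) (σ i)                  ≡⟨ gw₀-matches (σ i) c pj ⟩
        c                                    ∎
        where
        open ≡-Reasoning
        wi≡w₀i : lookup w i ≡ lookup w₀ i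
        wi≡w₀i = w-matches i (lookup w₀ i)
                   (trans (lookup∘tabulate _ i) (cong (λ t → constrain t (lookup w₀ i)) pj))
      ... | no ∄i = begin
        lookup (g w) j     ≡⟨ off-σ w j (λ i e → ∄i (i , e)) ⟩
        lookup base j      ≡⟨ off-σ w₀ j (λ i e → ∄i (i , e)) ⟨
        lookup (g w₀) j    ≡⟨ gw₀-matches j c pj ⟩
        c                  ∎
        where open ≡-Reasoning

  image-face : ∀ {B} → (∀ v → v ∈ B ⇔ (Σ (Vec Bool d) λ w → g w ≡ v)) → CubeFace n B
  image-face {B} B⇔image = p , λ v →
    mk⇔ (λ v∈B → image→ (fwd (B⇔image v) v∈B)) (λ m → bwd (B⇔image v) (image← v m))
    where
    cell : (j : Fin n) → Dec (∃ λ i → σ i ≡ j) → Maybe Bool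
    cell j (yes _) = nothing
    cell j (no _)  = just (lookup base j)
    p : Pat n
    p = tabulate λ j → cell j (any? λ i → σ i ≟ᶠ j)
    p-at : ∀ j → lookup p j ≡ cell j (any? λ i → σ i ≟ᶠ j)
    p-at j = lookup∘tabulate _ j
    image→ : ∀ {v} → (Σ (Vec Bool d) λ w → g w ≡ v) → Matches p v
    image→ (w , refl) = at⇒matches p (g w) λ j b e → fixed-coordinate j b (trans (sym (p-at j)) e)
      where
      fixed-coordinate : ∀ j b → cell j (any? λ i → σ i ≟ᶠ j) ≡ just b → lookup (g w) j ≡ b
      fixed-coordinate j b e with any? (λ i → σ i ≟ᶠ j)
      fixed-coordinate j b refl | no ∄i = off-σ w j (λ i e → ∄i (i , e))
    image← : ∀ v → Matches p v → Σ (Vec Bool d) λ w → g w ≡ v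
    image← v m = w , vec-ext (g w) v coordinate
      where
      w : Vec Bool d
      w = tabulate λ i → lookup base (σ i) xor lookup v (σ i)
      coordinate : ∀ j → lookup (g w) j ≡ lookup v j
      coordinate j with any? (λ i → σ i ≟ᶠ j) | p-at j
      ... | yes (i , refl) | _ = begin
        lookup (g w) (σ i)                                    ≡⟨ on-σ w i ⟩
        lookup base (σ i) xor lookup w i                      ≡⟨ cong (lookup base (σ i) xor_) (lookup∘tabulate _ i) ⟩
        lookup base (σ i) xor (lookup base (σ i) xor lookup v (σ i)) ≡⟨ xor-cancelˡ (lookup base (σ i)) _ ⟩
        lookup v (σ i)                                        ∎
        where open ≡-Reasoning
      ... | no ∄i | pj = trans (off-σ w j (λ i e → ∄i (i , e))) (sym (matches⇒at m j (lookup base j) pj))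

image-of-preimage : ∀ {d n} {g : Vec Bool d → Vec Bool n} {X Q Φ} →
                    (∀ w → g w ∈ X ⇔ w ∈ Q) → ImageOf g Q Φ →
                    ∀ v → v ∈ Φ ⇔ (v ∈ X × Σ (Vec Bool d) λ w → g w ≡ v)
image-of-preimage preimage image v = mk⇔
  (λ v∈Φ → let (w , w∈Q , gw≡v) = fwd (image v) v∈Φ
           in subst (_∈ _) gw≡v (bwd (preimage w) w∈Q) , w , gw≡v)
  (λ { (v∈X , w , refl) → bwd (image v) (w , fwd (preimage w) v∈X , refl) })

-- Sending u to the unique vertex of the face
-- of F̂ corresponding to {u} gives an injective vertex map h : I^d → F onto
-- F, which maps each face of I^d onto the corresponding face of F̂.
module FaceChart {n} (C : Complex n) (C⊆I : Subcomplex C (Cube n)) {F : BSet n} (F∈C : Face C F) where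

  private
    C-cubical = Subcomplex.cubical C⊆I

  d : ℕ
  d = proj₁ (IsCubical.cube-like C-cubical F F∈C)

  open InclusionIso (proj₂ (IsCubical.cube-like C-cubical F F∈C))

  face : CubeFaces d → BSet n
  face c = proj₁ (from c)

  face∈C : ∀ c → Face C (face c)
  face∈C c = proj₁ (proj₂ (from c))

  private
    vertexF : ∀ {v} → v ∈ F → Below C F
    vertexF {v} v∈F = singleton v ,
      IsCubical.vertices C-cubical v (IsCubical.faces⊆V C-cubical F F∈C v v∈F) , singleton-⊆ v∈F

    vertexI : Vec Bool d → CubeFaces d
    vertexI u = singleton u , singleton-face u

    toV : ∀ {v} → v ∈ F → BSet d
    toV v∈F = proj₁ (to (vertexF v∈F))

    toV-point : ∀ {v} (v∈F : v ∈ F) → Σ (Vec Bool d) λ x → x ∈ toV v∈F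
    toV-point v∈F = cubeFace-point (proj₂ (to (vertexF v∈F)))

    toV-⊆ : ∀ (G : Below C F) {v} → v ∈ proj₁ G → (v∈F : v ∈ F) → toV v∈F ⊆ proj₁ (to G)
    toV-⊆ G v∈G v∈F = to-mono (vertexF v∈F) G (singleton-⊆ v∈G)

    face-vertex-⊆ : ∀ {v} (v∈F : v ∈ F) {x} → x ∈ toV v∈F → face (vertexI x) ⊆ singleton v
    face-vertex-⊆ v∈F x∈ = subst (face (vertexI _) ⊆_) (from-to (vertexF v∈F))
      (from-mono (vertexI _) (to (vertexF v∈F)) (singleton-⊆ x∈))

  h : Vec Bool d → Vec Bool n
  h u = proj₁ (cubeFace-point (Subcomplex.Face⊆ C⊆I _ (face∈C (vertexI u))))

  private
    h∈ : ∀ u → h u ∈ face (vertexI u)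
    h∈ u = proj₂ (cubeFace-point (Subcomplex.Face⊆ C⊆I _ (face∈C (vertexI u))))

    h-toV : ∀ {v} (v∈F : v ∈ F) {x} → x ∈ toV v∈F → h x ≡ v
    h-toV v∈F x∈ = singleton-≡ (face-vertex-⊆ v∈F x∈ (h _) (h∈ _))

    face-⊆F : ∀ c → face c ⊆ F
    face-⊆F c = proj₂ (proj₂ (from c))

  h-image : ∀ c → ImageOf h (proj₁ c) (face c)
  h-image c v = mk⇔ image→ image←
    where
    image→ : v ∈ face c → Σ (Vec Bool d) λ u → u ∈ proj₁ c × h u ≡ v
    image→ v∈ = let v∈F = face-⊆F c v v∈ ; (x , x∈) = toV-point v∈F in
      x , subst (x ∈_) (to-from c) (toV-⊆ (from c) v∈ v∈F x x∈) , h-toV v∈F x∈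
    image← : (Σ (Vec Bool d) λ u → u ∈ proj₁ c × h u ≡ v) → v ∈ face c
    image← (u , u∈ , refl) = from-mono (vertexI u) c (singleton-⊆ u∈) (h u) (h∈ u)

  h-onto : ∀ {v} → v ∈ F → Σ (Vec Bool d) λ x → h x ≡ v
  h-onto v∈F = let (x , x∈) = toV-point v∈F in x , h-toV v∈F x∈

  -- if h a = v then a point x of toV v lies in to (face {a}) = {a}, so x = a
  h-injective : Injective _≡_ _≡_ h
  h-injective {a} {b} ha≡hb = trans (sym (pinned a refl)) (pinned b (sym ha≡hb))
    where
    v∈F = face-⊆F (vertexI a) (h a) (h∈ a)
    x = proj₁ (toV-point v∈F)
    pinned : ∀ u → h u ≡ h a → x ≡ u
    pinned u hu≡v = singleton-≡ (subst (x ∈_) (to-from (vertexI u))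
      (toV-⊆ (from (vertexI u)) (subst (_∈ face (vertexI u)) hu≡v (h∈ u)) v∈F x (proj₂ (toV-point v∈F))))

  -- the images of edges of I^d are faces of C, hence of I^n
  h-neighbours : NeighbourPreserving h
  h-neighbours w i = edge-to-edge h-injective w i
    (Subcomplex.Face⊆ C⊆I _ (face∈C edgeI)) (h-image edgeI)
    where
    edgeI : CubeFaces d
    edgeI = edge i w , patSet-face (edgePat i w)

-- Every face of I^n contained in a face F of C is a face of C: pulled back
-- along the chart of F it is a face of I^d, whose corresponding face of F̂
-- has the same vertices.
subcube-of-face : ∀ {n} (C : Complex n) → Subcomplex C (Cube n) →
                  ∀ {F X} → Face C F → CubeFace n X → X ⊆ F → Face C X
subcube-of-face C C⊆I {F} {X} F∈C X-face X⊆F = subst (Face C) face≡X (face∈C (Q , Q-face))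
  where
  open FaceChart C C⊆I F∈C
  x₀ = proj₁ (cubeFace-point X-face)
  x₀∈X = proj₂ (cubeFace-point X-face)
  preimage = preimage-face (coordinate-embedding h-injective h-neighbours) X-face
               (subst (_∈ _) (sym (proj₂ (h-onto (X⊆F x₀ x₀∈X)))) x₀∈X)
  Q = proj₁ preimage
  Q-face = proj₁ (proj₂ preimage)
  face⇔ = image-of-preimage (proj₂ (proj₂ preimage)) (h-image (Q , Q-face))
  face≡X : face (Q , Q-face) ≡ X
  face≡X = ⊆-antisym (λ v v∈ → proj₁ (fwd (face⇔ v) v∈))
                     (λ v v∈X → bwd (face⇔ v) (v∈X , h-onto (X⊆F v v∈X)))

another-direction : ∀ {k} → 1 ≤ k → (i : Fin (suc k)) → Σ (Fin (suc k)) λ i′ → i′ ≢ i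
another-direction (s≤s _) zero    = suc zero , λ ()
another-direction (s≤s _) (suc i) = zero , λ ()

module BoundarySphere {n k} (k≥1 : 1 ≤ k) (C : Complex n) (C⊆I : Subcomplex C (Cube n))
                      (S : Complex n) (S⊆C : Subcomplex S C) (iso : Iso S (BoundaryCube (suc k))) where
  open Iso iso

  private
    C-cubical = Subcomplex.cubical C⊆I

    C-face⇒cube : ∀ {Φ} → Face C Φ → CubeFace n Φ
    C-face⇒cube = Subcomplex.Face⊆ C⊆I _

    S-face⇒C : ∀ {Φ} → Face S Φ → Face C Φ
    S-face⇒C = Subcomplex.Face⊆ S⊆C _

  g-injective : Injective _≡_ _≡_ g
  g-injective {a} {b} ga≡gb = trans (sym (fg a (∈full a))) (trans (cong f ga≡gb) (fg b (∈full b)))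

  V-image : ∀ v → v ∈ V S ⇔ (Σ (Vec Bool (suc k)) λ w → g w ≡ v)
  V-image v = mk⇔ (λ v∈S → f v , gf v v∈S) (λ { (w , refl) → g-V w (∈full w) })

  proper-face-image : ∀ {Q} → CubeFace (suc k) Q → Q ≢ full →
                      Σ (BSet n) λ Φ → Face S Φ × ImageOf g Q Φ
  proper-face-image Q-face Q≢full = g-face _ (Q-face , Q≢full)

  -- since k ≥ 1, edges are proper faces, so g maps edges to edges
  g-neighbours : NeighbourPreserving g
  g-neighbours w i =
    let (Φ , Φ∈S , image) = proper-face-image (patSet-face (edgePat i w)) edge≢full
    in edge-to-edge g-injective w i (C-face⇒cube (S-face⇒C Φ∈S)) image
    where
    i′ = proj₁ (another-direction k≥1 i)
    edge≢full : edge i w ≢ full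
    edge≢full e with edge-members i w (subst (toggle i′ w ∈_) (sym e) (∈full (toggle i′ w)))
    ... | inj₁ eq = toggle-≢ i′ w eq
    ... | inj₂ eq = proj₂ (another-direction k≥1 i) (toggle-direction-injective w eq)

  g-embedding : CoordinateEmbedding g
  g-embedding = coordinate-embedding g-injective g-neighbours

  V-face : CubeFace n (V S)
  V-face = image-face g-embedding V-image

  image-∩ : ∀ {X Φ} → (∀ u → u ∈ Φ ⇔ (u ∈ X × Σ (Vec Bool (suc k)) λ w → g w ≡ u)) → Φ ≡ X ∩ V S
  image-∩ {X} Φ⇔ = ⊆-antisym
    (λ u u∈Φ → let (u∈X , u∈g) = fwd (Φ⇔ u) u∈Φ in bwd (∈-∩ X (V S) u) (u∈X , bwd (V-image u) u∈g))
    (λ u u∈ → let (u∈X , u∈S) = fwd (∈-∩ X (V S) u) u∈ in bwd (Φ⇔ u) (u∈X , fwd (V-image u) u∈S))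

  -- A face X of I^n meeting S either contains all of S or cuts out a face
  -- of S: the preimage of X is a face of I^(k+1), either all of it or proper.
  trace : ∀ {X} → CubeFace n X → (Σ (Vec Bool n) λ v → v ∈ X × v ∈ V S) → V S ⊆ X ⊎ Face S (X ∩ V S)
  trace {X} X-face (v , v∈X , v∈S) =
    let (Q , Q-face , preimage) = preimage-face g-embedding X-face (subst (_∈ X) (sym (gf v v∈S)) v∈X)
    in whole-or-proper Q-face preimage (Q ≟ₛ full)
    where
    whole-or-proper : ∀ {Q} → CubeFace (suc k) Q → (∀ w → g w ∈ X ⇔ w ∈ Q) → Dec (Q ≡ full) →
                      V S ⊆ X ⊎ Face S (X ∩ V S)
    whole-or-proper Q-face preimage (yes Q≡full) = inj₁ λ u u∈S →
      let (w , gw≡u) = fwd (V-image u) u∈S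
      in subst (_∈ X) gw≡u (bwd (preimage w) (subst (w ∈_) (sym Q≡full) (∈full w)))
    whole-or-proper Q-face preimage (no Q≢full) =
      let (Φ , Φ∈S , image) = proper-face-image Q-face Q≢full
      in inj₂ (subst (Face S) (image-∩ (image-of-preimage preimage image)) Φ∈S)

  V-not-in-vertex : ∀ v → ¬ (V S ⊆ singleton v)
  V-not-in-vertex v V⊆v = toggle-≢ zero w (g-injective (trans (sent-to-v (toggle zero w)) (sym (sent-to-v w))))
    where
    w = replicate (suc k) false
    sent-to-v : ∀ u → g u ≡ v
    sent-to-v u = singleton-≡ (V⊆v (g u) (g-V u (∈full u)))

  -- a face of S misses a vertex of S, since ∂I^(k+1) has no top face
  face≢V : ∀ {G} → Face S G → G ≢ V S
  face≢V {G} G∈S G≡V =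
    let (G′ , (_ , G′≢full) , G′⇔fG) = f-face G G∈S
        in-G′ : ∀ w → w ∈ G′
        in-G′ w = bwd (G′⇔fG w) (g w , subst (g w ∈_) (sym G≡V) (g-V w (∈full w)) , fg w (∈full w))
    in G′≢full (⊆-antisym (λ w _ → ∈full w) (λ w _ → in-G′ w))

  boundary-of-V : ∀ {F} → Face C F → V S ⊆ F → Σ (BSet n) λ F → Face C F × IsBoundaryOf C F S
  boundary-of-V F∈C V⊆F =
    V S , subcube-of-face C C⊆I F∈C V-face V⊆F ,
    (λ G → mk⇔ (face→ G) (face← G)) , (λ v → mk⇔ (vertex→ v) (vertex← v))
    where
    face→ : ∀ G → Face S G → Face C G × G ⊆ V S × G ≢ V S
    face→ G G∈S = S-face⇒C G∈S , IsCubical.faces⊆V (Subcomplex.cubical S⊆C) G G∈S , face≢V G∈S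
    -- a proper face G of C inside S meets S in G itself, so G ∈ S by trace
    face← : ∀ G → Face C G × G ⊆ V S × G ≢ V S → Face S G
    face← G (G∈C , G⊆V , G≢V) = conclude (trace (C-face⇒cube G∈C) (v , v∈G , G⊆V v v∈G))
      where
      v = proj₁ (cubeFace-point (C-face⇒cube G∈C))
      v∈G = proj₂ (cubeFace-point (C-face⇒cube G∈C))
      conclude : V S ⊆ G ⊎ Face S (G ∩ V S) → Face S G
      conclude (inj₁ V⊆G)   = ⊥-elim (G≢V (⊆-antisym G⊆V V⊆G))
      conclude (inj₂ G∩V∈S) = subst (Face S) (∩-absorbs G⊆V) G∩V∈S
    vertex→ : ∀ v → v ∈ V S → Face C (singleton v) × singleton v ⊆ V S × singleton v ≢ V S
    vertex→ v v∈S = IsCubical.vertices C-cubical v (Subcomplex.V⊆ S⊆C v v∈S) , singleton-⊆ v∈S ,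
                    λ e → V-not-in-vertex v (subst (_⊆ singleton v) e (λ _ u∈ → u∈))
    vertex← : ∀ v → Face C (singleton v) × singleton v ⊆ V S × singleton v ≢ V S → v ∈ V S
    vertex← v (_ , v⊆V , _) = v⊆V v (∈-singleton v)

  -- The vertices of a face F with S = ∂F̂ are vertices of S: F is not
  -- itself a vertex, as it contains the two distinct vertices of S.
  boundary-vertices : ∀ {F} → Face C F → IsBoundaryOf C F S → F ⊆ V S
  boundary-vertices {F} F∈C (_ , vertices⇔) v v∈F = bwd (vertices⇔ v)
    (IsCubical.vertices C-cubical v (IsCubical.faces⊆V C-cubical F F∈C v v∈F) , singleton-⊆ v∈F , v≢F)
    where
    V⊆F : V S ⊆ F
    V⊆F u u∈S = proj₁ (proj₂ (fwd (vertices⇔ u) u∈S)) u (∈-singleton u)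
    v≢F : singleton v ≢ F
    v≢F e = V-not-in-vertex v (subst (V S ⊆_) (sym e) V⊆F)

  -- If S = ∂F̂, then F meets S in F, which is not a face of S: S is not face-like.
  face-like⇒not-boundary : FaceLike C S → ¬ (Σ (BSet n) λ F → Face C F × IsBoundaryOf C F S)
  face-like⇒not-boundary face-like (F , F∈C , faces⇔ , vertices⇔) = absurd (face-like F F∈C)
    where
    F⊆V : F ⊆ V S
    F⊆V = boundary-vertices F∈C (faces⇔ , vertices⇔)
    F∉S : ¬ Face S F
    F∉S F∈S = proj₂ (proj₂ (fwd (faces⇔ F) F∈S)) refl
    absurd : IsEmpty (F ∩ V S) ⊎ Face S (F ∩ V S) → ⊥
    absurd (inj₁ F∩V-empty) = F∩V-empty v (bwd (∈-∩ F (V S) v) (v∈F , F⊆V v v∈F))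
      where
      v = proj₁ (cubeFace-point (C-face⇒cube F∈C))
      v∈F = proj₂ (cubeFace-point (C-face⇒cube F∈C))
    absurd (inj₂ F∩V∈S) = F∉S (subst (Face S) (∩-absorbs F⊆V) F∩V∈S)

  -- Conversely, by trace a face of C meeting S either cuts out a face of S,
  -- or contains S, and then S is a boundary.
  not-boundary⇒face-like : ¬ (Σ (BSet n) λ F → Face C F × IsBoundaryOf C F S) → FaceLike C S
  not-boundary⇒face-like not-boundary F F∈C = split (nonempty? (F ∩ V S))
    where
    conclude : V S ⊆ F ⊎ Face S (F ∩ V S) → Face S (F ∩ V S)
    conclude (inj₁ V⊆F)   = ⊥-elim (not-boundary (boundary-of-V F∈C V⊆F))
    conclude (inj₂ F∩V∈S) = F∩V∈S
    split : (Σ (Vec Bool n) λ v → v ∈ F ∩ V S) ⊎ IsEmpty (F ∩ V S) → IsEmpty (F ∩ V S) ⊎ Face S (F ∩ V S)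
    split (inj₁ (v , v∈)) = inj₂ (conclude (trace (C-face⇒cube F∈C) (v , fwd (∈-∩ F (V S) v) v∈)))
    split (inj₂ empty)    = inj₁ empty

lemma3p4 : (n k : ℕ) → 1 ≤ k → (C : Complex n) → Subcomplex C (Cube n) →
           (S : Complex n) → Subcomplex S C → Iso S (BoundaryCube (suc k)) →
           FaceLike C S ⇔ (¬ Σ (BSet n) λ F → Face C F × IsBoundaryOf C F S)
lemma3p4 n k k≥1 C C⊆I S S⊆C iso = mk⇔ face-like⇒not-boundary not-boundary⇒face-like
  where open BoundarySphere k≥1 C C⊆I S S⊆C iso
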